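{- Let $k\ge 3$. 1. If $m=_{k\text{ -nf}}A_a(k,b)+l$ and $l>0$, then $A_a(k,b)+(l-1)$ is the $k$-normal form of $m-1$ (i.e. $m-1=_{k\text{ -nf}}A_a(k,b)+(l-1)$). 2. If $m=_{k\text{ -nf}}A_a(k,b)$ (with $l=0$) and $b>0$, then $A_a(k,b-1)=_{k\text{ -nf}}A_a(k,b-1)$, i.e. $A_a(k,b-1)$ is in $k$-normal form. 3. If $m=_{k\text{ -nf}}A_a(k,0)$, then for every $0<l<k$ the number $A_a(k,\cdot)^l(0)$ is in $k$-normal form as $A_a(k,A_a(k,\cdot)^{l-1}(0))$.
   Context: For natural numbers $k,a,b$: $A_0(k,b):=b+1$, $A_{a+1}(k,0):=A_a(k,\cdot)^k(0)$, $A_{a+1}(k,b+1):=A_a(k,\cdot)^k(A_{a+1}(k,b))$, where the upper index denotes iteration of $x\mapsto A_a(k,x)$. For $k\ge3$ and $m>0$ there are unique $a,b,l$ with $m=A_a(k,b)+l$, $a$ maximal with $A_a(k,0)\le m$ and $b$ maximal with $A_a(k,b)\le m$; this is written $m=_{k\text{ -nf}}A_a(k,b)+l$, and an expression $A_a(k,b)+l$ is said to be in $k$-normal form if it is the $k$-normal form of the number it denotes. -}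

module Defs where

open import Data.Nat using (ℕ; zero; suc; _+_; _≤_; _<_)
open import Data.Product using (_×_)
open import Relation.Binary.PropositionalEquality using (_≡_)

iter : (ℕ → ℕ) → ℕ → ℕ → ℕ
iter f zero    x = x
iter f (suc n) x = f (iter f n x)

-- Ackermann-type function A_a(k,b), written A k a b
A : ℕ → ℕ → ℕ → ℕ
A k zero    b       = suc b
A k (suc a) zero    = iter (A k a) k 0
A k (suc a) (suc b) = iter (A k a) k (A k (suc a) b)

NF : ℕ → ℕ → ℕ → ℕ → ℕ → Set
NF k m a b l =
  (0 < m)
  × (m ≡ A k a b + l)
  × (A k a 0 ≤ m)
  × (∀ a' → A k a' 0 ≤ m → a' ≤ a)
  × (A k a b ≤ m)
  × (∀ b' → A k a b' ≤ m → b' ≤ b)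

-- The proof only needs elementary monotonicity facts, which hold for every
-- k ≥ 1:
--   * every A_a(k,·) is inflationary and strictly increasing, and
--     A_a(k,0) is non-decreasing in a;
--   * both maximality conditions of a normal form are downward closed in m,
--     so they survive when m is replaced by a smaller number ≥ A_a(k,b);
--   * a value A_a(k,b) below A_{a+1}(k,0) is automatically in normal form
--     A_a(k,b) + 0, since b is recovered by strict monotonicity.
-- Part 1 and part 2 follow from downward closure, part 3 from the last
-- fact, because A_a(k,·)^l(0) < A_a(k,·)^k(0) = A_{a+1}(k,0) for l < k.
module Submission where

open import Defs
open import Data.Nat using (ℕ; _≤_; _<_; _∸_; zero; suc; _+_; z≤n; s≤s; _≤?_)
open import Data.Nat.Properties
open import Data.Product using (_×_; _,_)
open import Relation.Nullary using (yes; no; contradiction)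
open import Relation.Binary.PropositionalEquality using (refl; sym)

≤-steps⇒monotone : (s : ℕ → ℕ) → (∀ n → s n ≤ s (suc n)) →
                   ∀ {m n} → m ≤ n → s m ≤ s n
≤-steps⇒monotone s step {zero}  {zero}  z≤n       = ≤-refl
≤-steps⇒monotone s step {zero}  {suc n} z≤n       =
  ≤-trans (≤-steps⇒monotone s step {zero} {n} z≤n) (step n)
≤-steps⇒monotone s step {suc m} {suc n} (s≤s m≤n) =
  ≤-steps⇒monotone (λ i → s (suc i)) (λ i → step (suc i)) m≤n

<-steps⇒strictMono : (s : ℕ → ℕ) → (∀ n → s n < s (suc n)) →
                     ∀ {m n} → m < n → s m < s n
<-steps⇒strictMono s step {m} m<n =
  <-≤-trans (step m) (≤-steps⇒monotone s (λ i → <⇒≤ (step i)) m<n)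

<-steps⇒reflects≤ : (s : ℕ → ℕ) → (∀ n → s n < s (suc n)) →
                    ∀ m n → s m ≤ s n → m ≤ n
<-steps⇒reflects≤ s step m n sm≤sn with m ≤? n
... | yes m≤n = m≤n
... | no  m≰n = contradiction sm≤sn (<⇒≱ (<-steps⇒strictMono s step (≰⇒> m≰n)))

iter-inflationary : (f : ℕ → ℕ) → (∀ y → y < f y) → ∀ n x → n + x ≤ iter f n x
iter-inflationary f infl zero    x = ≤-refl
iter-inflationary f infl (suc n) x =
  ≤-<-trans (iter-inflationary f infl n x) (infl (iter f n x))

iter-strictMono : (f : ℕ → ℕ) → (∀ y → y < f y) →
                  ∀ x {m n} → m < n → iter f m x < iter f n x
iter-strictMono f infl x = <-steps⇒strictMono (λ n → iter f n x) (λ n → infl (iter f n x))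

module Hierarchy (j : ℕ) where

  k : ℕ
  k = suc j

  -- Every level A_a(k,·) is inflationary: A_{a+1}(k,·) applies the
  -- inflationary A_a(k,·) k ≥ 1 times.
  A-inflationary : ∀ a b → b < A k a b
  A-inflationary zero    b       = n<1+n b
  A-inflationary (suc a) zero    =
    ≤-trans (s≤s z≤n) (iter-inflationary (A k a) (A-inflationary a) k 0)
  A-inflationary (suc a) (suc b) =
    ≤-trans (s≤s (≤-trans (A-inflationary (suc a) b) (m≤n+m _ j)))
            (iter-inflationary (A k a) (A-inflationary a) k (A k (suc a) b))

  A-step : ∀ a b → A k a b < A k a (suc b)
  A-step zero    b = n<1+n _
  A-step (suc a) b =
    ≤-trans (s≤s (m≤n+m _ j))
            (iter-inflationary (A k a) (A-inflationary a) k (A k (suc a) b))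

  A-monotone : ∀ a {b c} → b ≤ c → A k a b ≤ A k a c
  A-monotone a = ≤-steps⇒monotone (A k a) (λ b → <⇒≤ (A-step a b))

  A-reflects≤ : ∀ a b c → A k a b ≤ A k a c → b ≤ c
  A-reflects≤ a = <-steps⇒reflects≤ (A k a) (A-step a)

  -- A_a(k,0) is non-decreasing in a, as A_{a+1}(k,0) = A_a(k, A_a(k,·)^{k-1}(0)).
  A-level-monotone : ∀ {a a'} → a ≤ a' → A k a 0 ≤ A k a' 0
  A-level-monotone = ≤-steps⇒monotone (λ a → A k a 0) level-step
    where
    level-step : ∀ a → A k a 0 ≤ A k (suc a) 0
    level-step a = A-monotone a z≤n

  A-positive : ∀ a b → 0 < A k a b
  A-positive a b = ≤-<-trans z≤n (A-inflationary a b)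

  LevelMaximal : ℕ → ℕ → Set
  LevelMaximal a n = ∀ a' → A k a' 0 ≤ n → a' ≤ a

  maximal-antitone : (f : ℕ → ℕ) (c : ℕ) {m n : ℕ} → n ≤ m →
                     (∀ x → f x ≤ m → x ≤ c) → (∀ x → f x ≤ n → x ≤ c)
  maximal-antitone f c n≤m max x fx≤n = max x (≤-trans fx≤n n≤m)

  below-next-level : ∀ a n → n < A k (suc a) 0 → LevelMaximal a n
  below-next-level a n n<next a' level≤n with a' ≤? a
  ... | yes a'≤a = a'≤a
  ... | no  a'≰a = contradiction (≤-<-trans (A-level-monotone (≰⇒> a'≰a))
                                             (≤-<-trans level≤n n<next))
                                 (<-irrefl refl)

  value-nf : ∀ a b → LevelMaximal a (A k a b) → NF k (A k a b) a b 0
  value-nf a b level-max =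
    ( A-positive a b , sym (+-identityʳ _) , A-monotone a z≤n
    , level-max , ≤-refl , (λ b' Ab'≤Ab → A-reflects≤ a b' b Ab'≤Ab))

  nf-pred-remainder : ∀ m a b l → NF k m a b l → 0 < l → NF k (m ∸ 1) a b (l ∸ 1)
  nf-pred-remainder m a b (suc l) (_ , refl , _ , level-max , _ , arg-max) _
    rewrite +-suc (A k a b) l =
    ( <-≤-trans (A-positive a b) (m≤m+n (A k a b) l) , refl
    , ≤-trans (A-monotone a z≤n) (m≤m+n (A k a b) l)
    , maximal-antitone (λ a' → A k a' 0) a below level-max
    , m≤m+n (A k a b) l
    , maximal-antitone (A k a) b below arg-max)
    where
    below : A k a b + l ≤ suc (A k a b + l)
    below = n≤1+n _

  nf-pred-argument : ∀ m a b → NF k m a b 0 → 0 < b → NF k (A k a (b ∸ 1)) a (b ∸ 1) 0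
  nf-pred-argument m a (suc b) (_ , _ , _ , level-max , Ab≤m , _) _ =
    value-nf a b (maximal-antitone (λ a' → A k a' 0) a below level-max)
    where
    below : A k a b ≤ m
    below = ≤-trans (<⇒≤ (A-step a b)) Ab≤m

  -- Part 3: fewer than k iterates of A_a(k,·) from 0 stay below A_{a+1}(k,0).
  nf-iterate : ∀ m a → NF k m a 0 0 → ∀ l → 0 < l → l < k →
               NF k (iter (A k a) l 0) a (iter (A k a) (l ∸ 1) 0) 0
  nf-iterate m a _ (suc l) _ l<k =
    value-nf a (iter (A k a) l 0)
      (below-next-level a _ (iter-strictMono (A k a) (A-inflationary a) 0 l<k))

mainTheorem3 : (k : ℕ) → 3 ≤ k →
    ((m a b l : ℕ) → NF k m a b l → 0 < l → NF k (m ∸ 1) a b (l ∸ 1))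
    × ((m a b : ℕ) → NF k m a b 0 → 0 < b → NF k (A k a (b ∸ 1)) a (b ∸ 1) 0)
    × ((m a : ℕ) → NF k m a 0 0 → (l : ℕ) → 0 < l → l < k →
    NF k (iter (A k a) l 0) a (iter (A k a) (l ∸ 1) 0) 0)
mainTheorem3 (suc j) _ = nf-pred-remainder , nf-pred-argument , nf-iterate
  where open Hierarchy j
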